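{- Let $G$ be a finite simple connected graph, $\mathcal P$ an edge-clique partition of the line graph $G^*$, and $v$ a vertex of $G$ that is the stalk vertex of exactly $t\ge1$ $v$-wings. Then $\mathcal P$ contains at least $2t+1$ cliques.
   Context: The line graph $G^*$ has vertex set $E(G)$, two edges adjacent iff they share an endpoint. An edge-clique partition of a graph $H$ is a family of cliques of $H$ (single vertices allowed) whose union is $V(H)$ and such that every edge of $H$ lies in exactly one of the cliques. A $v$-wing is a triangle $vxy$ of $G$ with $d(x)=d(y)=2$ and $d(v)>2$; $v$ is its stalk vertex. -}

module Defs where

open import Data.Nat using (ℕ; zero; suc; _+_; _<ᵇ_; _≡ᵇ_)
open import Data.Fin using (Fin; toℕ)
open import Data.Bool using (Bool; true; false; _∧_; if_then_else_)
open import Data.List using (List; map; allFin; length; lookup)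
open import Data.Nat.ListAction using (sum)
open import Data.List.Membership.Propositional using (_∈_)
open import Data.Product using (Σ; _×_; ∃)
open import Data.Sum using (_⊎_)
open import Relation.Nullary using (¬_)
open import Relation.Binary.PropositionalEquality using (_≡_)

record SimpleGraph (n : ℕ) : Set where
  field
    adj   : Fin n → Fin n → Bool
    sym   : ∀ i j → adj i j ≡ adj j i
    irrfl : ∀ i → adj i i ≡ false
open SimpleGraph public

module _ {n : ℕ} (G : SimpleGraph n) where

  data Reach : Fin n → Fin n → Set where
    here : ∀ {u} → Reach u u
    step : ∀ {u x w} → adj G u x ≡ true → Reach x w → Reach u w

  Connected : Set
  Connected = ∀ u w → Reach u w

  degree : Fin n → ℕ
  degree v = sum (map (λ j → if adj G v j then 1 else 0) (allFin n))

  -- an edge {a,b} of G, stored with a < b (so each edge appears once)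
  record Edge : Set where
    constructor edge
    field
      lo hi : Fin n
      lo<hi : (toℕ lo <ᵇ toℕ hi) ≡ true
      isAdj : adj G lo hi ≡ true
  open Edge public

  LineAdj : Edge → Edge → Set
  LineAdj e f = ¬ (e ≡ f) ×
    (lo e ≡ lo f ⊎ lo e ≡ hi f ⊎ hi e ≡ lo f ⊎ hi e ≡ hi f)

  IsClique : List Edge → Set
  IsClique C = ∀ {e f} → e ∈ C → f ∈ C → ¬ (e ≡ f) → LineAdj e f

  record EdgeCliquePartition (P : List (List Edge)) : Set where
    field
      cliques : ∀ k → IsClique (lookup P k)
      covers  : ∀ e → ∃ λ k → e ∈ lookup P k
      exists1 : ∀ e f → LineAdj e f → ∃ λ k → e ∈ lookup P k × f ∈ lookup P k
      unique1 : ∀ e f → LineAdj e f → ∀ k k' →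
                e ∈ lookup P k → f ∈ lookup P k →
                e ∈ lookup P k' → f ∈ lookup P k' → k ≡ k'

  isWing : Fin n → Fin n → Fin n → Bool
  isWing v x y = (toℕ x <ᵇ toℕ y) ∧ adj G v x ∧ adj G v y ∧ adj G x y
               ∧ (degree x ≡ᵇ 2) ∧ (degree y ≡ᵇ 2) ∧ (2 <ᵇ degree v)

  -- number of v-wings (each wing counted once, as an unordered pair {x,y})
  wingCount : Fin n → ℕ
  wingCount v = sum (map (λ x → sum (map (λ y → if isWing v x y then 1 else 0)
                                        (allFin n))) (allFin n))

module Submission where

-- Each clique of the partition contains at most one wing edge xy, and the edge xy of a v-wing lies in
-- two cliques (one through vx, one through vy) unless vx, vy, xy lie in a common clique; call the wing
-- triangular then.  This gives t + b cliques, b the number of non-triangular wings.  The remaining,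
-- wing-free cliques restricted to the edges at v partition the pairs of the d(v) ≥ 3 edges at v except
-- the pairs {vx, vy} of triangular wings, a matching of size t − b.  For such a partition into s blocks,
-- let K be a largest block, of size k, and o the number of vertices outside K.  Counting the unmatched
-- pairs X between K and the outside in two ways gives k·o ≤ X + k and X + (k − 1) ≤ (k − 1)·s, so
-- s ≥ o + 1 when o ≥ 2; and every matched pair has an endpoint outside K.  Hence s ≥ t − b + 1.

open import Defs renaming (sym to adj-sym)
open import Axiom.UniquenessOfIdentityProofs using (module Decidable⇒UIP)
open import Data.Bool using (Bool; true; false; _∧_; _∨_; not; T; if_then_else_)
import Data.Bool as Bool
open import Data.Bool.Properties using (∨-zeroʳ; T-≡)
open import Data.Empty using (⊥; ⊥-elim)
open import Data.Fin using (Fin; zero; suc; toℕ)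
import Data.Fin as Fin
import Data.Fin.Properties as Finₚ
open import Data.List using (List; length; lookup; allFin; map; tabulate)
open import Data.List.Membership.Propositional using (_∈_; find; lose)
open import Data.List.Properties using (map-tabulate)
open import Data.List.Relation.Unary.Any using (any?)
open import Data.Nat using (ℕ; zero; suc; _+_; _*_; _∸_; _≤_; _<_; z≤n; s≤s; _<ᵇ_; _≡ᵇ_; _≤?_)
import Data.Nat.ListAction as List
open import Data.Nat.Properties
open import Algebra.Properties.Semiring.Sum +-*-semiring
  using (sum; ∑-distrib-+; ∑-comm; sum-cong-≗; *-distribˡ-sum; *-distribʳ-sum)
open import Data.Nat.Tactic.RingSolver using (solve-∀)
open import Data.Product using (_×_; _,_; ∃; proj₁; proj₂)
open import Data.Sum using (_⊎_; inj₁; inj₂)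
open import Function using (_∘_; id)
open import Function.Bundles using (Equivalence)
open import Relation.Binary.Definitions using (tri<; tri≈; tri>)
open import Relation.Binary.PropositionalEquality
open import Relation.Nullary using (yes; no; Dec; does)
open import Relation.Nullary.Decidable using (⌊_⌋; dec-true; map′; _×-dec_; _⊎-dec_)

𝟙 : Bool → ℕ
𝟙 b = if b then 1 else 0

𝟙≤1 : ∀ b → 𝟙 b ≤ 1
𝟙≤1 true  = ≤-refl
𝟙≤1 false = z≤n

1≤𝟙⇒≡true : ∀ {b} → 1 ≤ 𝟙 b → b ≡ true
1≤𝟙⇒≡true {true} _ = refl

≡true⇒1≤𝟙 : ∀ {b} → b ≡ true → 1 ≤ 𝟙 b
≡true⇒1≤𝟙 refl = ≤-refl

∧-elim : ∀ {a b} → (a ∧ b) ≡ true → a ≡ true × b ≡ true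
∧-elim {true} h = refl , h

true≢false : true ≢ false
true≢false ()

does⇒ : ∀ {A : Set} (a? : Dec A) → does a? ≡ true → A
does⇒ (yes a) _ = a

sum-allFin : ∀ n (f : Fin n → ℕ) → List.sum (map f (allFin n)) ≡ sum f
sum-allFin n f = trans (cong List.sum (map-tabulate id f)) (go n f)
  where
  go : ∀ n (f : Fin n → ℕ) → List.sum (tabulate f) ≡ sum f
  go zero    f = refl
  go (suc n) f = cong (f zero +_) (go n (f ∘ suc))

∑-mono-≤ : ∀ {n} {f g : Fin n → ℕ} → (∀ i → f i ≤ g i) → sum f ≤ sum g
∑-mono-≤ {zero}  h = z≤n
∑-mono-≤ {suc n} h = +-mono-≤ (h zero) (∑-mono-≤ (h ∘ suc))

∑-*ˡ : ∀ {n} c (f : Fin n → ℕ) → sum (λ i → c * f i) ≡ c * sum f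
∑-*ˡ c f = sym (*-distribˡ-sum c f)

∑-*ʳ : ∀ {n} c (f : Fin n → ℕ) → sum (λ i → f i * c) ≡ sum f * c
∑-*ʳ c f = sym (*-distribʳ-sum c f)

∑-const : ∀ n c → sum {n} (λ _ → c) ≡ n * c
∑-const zero    c = refl
∑-const (suc n) c = cong (c +_) (∑-const n c)

∑-zero : ∀ {n} (f : Fin n → ℕ) → (∀ i → f i ≡ 0) → sum f ≡ 0
∑-zero {zero}  f h = refl
∑-zero {suc n} f h rewrite h zero = ∑-zero (f ∘ suc) (h ∘ suc)

term≤∑ : ∀ {n} (f : Fin n → ℕ) i → f i ≤ sum f
term≤∑ f zero    = m≤m+n (f zero) _
term≤∑ f (suc i) = ≤-trans (term≤∑ (f ∘ suc) i) (m≤n+m _ (f zero))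

∑-positive⇒∃ : ∀ {n} (f : Fin n → ℕ) → 1 ≤ sum f → ∃ λ i → 1 ≤ f i
∑-positive⇒∃ {suc n} f h with f zero in eq
... | suc _ = zero , subst (1 ≤_) (sym eq) (s≤s z≤n)
... | zero with ∑-positive⇒∃ (f ∘ suc) h
... | i , p = suc i , p

∑≤1 : ∀ {n} (f : Fin n → ℕ) → (∀ i → f i ≤ 1) →
      (∀ i j → 1 ≤ f i → 1 ≤ f j → i ≡ j) → sum f ≤ 1
∑≤1 {zero}  f bound unique = z≤n
∑≤1 {suc n} f bound unique with f zero in eq
... | zero  = ∑≤1 (f ∘ suc) (bound ∘ suc) (λ i j p q → Finₚ.suc-injective (unique (suc i) (suc j) p q))
... | suc m = subst (λ s → suc m + s ≤ 1) (sym (∑-zero (f ∘ suc) rest-zero))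
                (subst (_≤ 1) (trans eq (sym (+-identityʳ (suc m)))) (bound zero))
  where
  rest-zero : ∀ i → f (suc i) ≡ 0
  rest-zero i with f (suc i) in eq′
  ... | zero  = refl
  ... | suc _ with unique zero (suc i) (subst (1 ≤_) (sym eq) (s≤s z≤n)) (subst (1 ≤_) (sym eq′) (s≤s z≤n))
  ... | ()

δ : ∀ {n} → Fin n → Fin n → ℕ
δ i p = 𝟙 ⌊ i Fin.≟ p ⌋

δ-refl : ∀ {n} (p : Fin n) → δ p p ≡ 1
δ-refl p with p Fin.≟ p
... | yes _ = refl
... | no ¬p = ⊥-elim (¬p refl)

δ-≢ : ∀ {n} {i p : Fin n} → i ≢ p → δ i p ≡ 0
δ-≢ {i = i} {p} i≢p with i Fin.≟ p
... | yes i≡p = ⊥-elim (i≢p i≡p)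
... | no _ = refl

∑-δ : ∀ {n} (p : Fin n) → sum (λ i → δ i p) ≡ 1
∑-δ {suc n} zero    = cong suc (∑-zero {n} _ (λ _ → refl))
∑-δ {suc n} (suc p) = trans (sum-cong-≗ shift) (∑-δ p)
  where
  shift : ∀ i → δ (suc i) (suc p) ≡ δ i p
  shift i with i Fin.≟ p
  ... | yes refl = refl
  ... | no _ = refl

2≤∑ : ∀ {n} (f : Fin n → ℕ) {i j} → i ≢ j → 1 ≤ f i → 1 ≤ f j → 2 ≤ sum f
2≤∑ f {i} {j} i≢j fi fj = begin
  2                                   ≡⟨ sym (cong₂ _+_ (∑-δ i) (∑-δ j)) ⟩
  sum (λ x → δ x i) + sum (λ x → δ x j) ≡⟨ sym (∑-distrib-+ (λ x → δ x i) (λ x → δ x j)) ⟩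
  sum (λ x → δ x i + δ x j)           ≤⟨ ∑-mono-≤ pointwise ⟩
  sum f                               ∎
  where
  open ≤-Reasoning
  pointwise : ∀ x → δ x i + δ x j ≤ f x
  pointwise x with x Fin.≟ i | x Fin.≟ j
  ... | yes refl | yes refl = ⊥-elim (i≢j refl)
  ... | yes refl | no _     = subst (_≤ f x) (sym (+-identityʳ 1)) fi
  ... | no _     | yes refl = fj
  ... | no _     | no _     = z≤n

3≤∑ : ∀ {n} (f : Fin n → ℕ) {i j l} → i ≢ j → i ≢ l → j ≢ l → 1 ≤ f i → 1 ≤ f j → 1 ≤ f l → 3 ≤ sum f
3≤∑ f {i} {j} {l} i≢j i≢l j≢l fi fj fl = begin
  3                                                        ≡⟨ sym (cong₂ _+_ (cong₂ _+_ (∑-δ i) (∑-δ j)) (∑-δ l)) ⟩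
  sum (λ x → δ x i) + sum (λ x → δ x j) + sum (λ x → δ x l)
    ≡⟨ sym (cong (_+ sum (λ x → δ x l)) (∑-distrib-+ (λ x → δ x i) (λ x → δ x j))) ⟩
  sum (λ x → δ x i + δ x j) + sum (λ x → δ x l)            ≡⟨ sym (∑-distrib-+ (λ x → δ x i + δ x j) (λ x → δ x l)) ⟩
  sum (λ x → δ x i + δ x j + δ x l)                        ≤⟨ ∑-mono-≤ pointwise ⟩
  sum f                                                    ∎
  where
  open ≤-Reasoning
  pointwise : ∀ x → δ x i + δ x j + δ x l ≤ f x
  pointwise x with x Fin.≟ i | x Fin.≟ j | x Fin.≟ l
  ... | yes refl | yes refl | _        = ⊥-elim (i≢j refl)
  ... | yes refl | no _     | yes refl = ⊥-elim (i≢l refl)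
  ... | no _     | yes refl | yes refl = ⊥-elim (j≢l refl)
  ... | yes refl | no _     | no _     = subst (_≤ f x) (sym (+-identityʳ 1)) fi
  ... | no _     | yes refl | no _     = subst (_≤ f x) (sym (+-identityʳ 1)) fj
  ... | no _     | no _     | yes refl = fl
  ... | no _     | no _     | no _     = z≤n

argmax : ∀ {n} → Fin n → (f : Fin n → ℕ) → ∃ λ K → ∀ L → f L ≤ f K
argmax {suc zero}    zero f = zero , λ { zero → ≤-refl }
argmax {suc (suc n)} _    f with argmax {suc n} zero (f ∘ suc)
... | K , max with f zero ≤? f (suc K)
... | yes p = suc K , λ { zero → p ; (suc L) → max L }
... | no ¬p = zero  , λ { zero → ≤-refl ; (suc L) → ≤-trans (max L) (<⇒≤ (≰⇒> ¬p)) }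

-- From k·o ≤ x + k and x + (k − 1) ≤ (k − 1)·s, the assumption s ≤ o would give o ≤ 1.
outside<blocks : ∀ k o x s → 1 ≤ k → 2 ≤ o → k * o ≤ x + k → x + (k ∸ 1) ≤ (k ∸ 1) * s → o + 1 ≤ s
outside<blocks (suc j) o x s _ 2≤o lower upper with o + 1 ≤? s
... | yes o<s = o<s
... | no o≮s = ⊥-elim (<⇒≱ 2≤o (+-cancelʳ-≤ (j * o) o 1 chain))
  where
  s≤o : s ≤ o
  s≤o = ≤-pred (subst (s <_) (+-comm o 1) (≰⇒> o≮s))
  chain : o + j * o ≤ 1 + j * o
  chain = begin
    o + j * o      ≤⟨ lower ⟩
    x + suc j      ≡⟨ +-suc x j ⟩
    suc (x + j)    ≤⟨ s≤s upper ⟩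
    suc (j * s)    ≤⟨ s≤s (*-monoʳ-≤ j s≤o) ⟩
    1 + j * o      ∎
    where open ≤-Reasoning

Overlap : ∀ {A : Set} → A → A → A → A → Set
Overlap a b c d = a ≡ c ⊎ a ≡ d ⊎ b ≡ c ⊎ b ≡ d

Overlap-swapˡ : ∀ {A : Set} {a b c d : A} → Overlap a b c d → Overlap b a c d
Overlap-swapˡ (inj₁ p)                = inj₂ (inj₂ (inj₁ p))
Overlap-swapˡ (inj₂ (inj₁ p))         = inj₂ (inj₂ (inj₂ p))
Overlap-swapˡ (inj₂ (inj₂ (inj₁ p)))  = inj₁ p
Overlap-swapˡ (inj₂ (inj₂ (inj₂ p)))  = inj₂ (inj₁ p)

Overlap-swapʳ : ∀ {A : Set} {a b c d : A} → Overlap a b c d → Overlap a b d c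
Overlap-swapʳ (inj₁ p)                = inj₂ (inj₁ p)
Overlap-swapʳ (inj₂ (inj₁ p))         = inj₁ p
Overlap-swapʳ (inj₂ (inj₂ (inj₁ p)))  = inj₂ (inj₂ (inj₂ p))
Overlap-swapʳ (inj₂ (inj₂ (inj₂ p)))  = inj₂ (inj₂ (inj₁ p))

-- Edge-clique partitions of a complete graph minus a matching

record PartitionOfCompleteMinusMatching (n N : ℕ) : Set where
  field
    vertex  : Fin n → Bool
    matched : Fin n → Fin n → Bool
    member  : Fin n → Fin N → Bool
    used    : Fin N → Bool
    three-vertices    : 3 ≤ sum (𝟙 ∘ vertex)
    matched-vertices  : ∀ {x y} → matched x y ≡ true → vertex x ≡ true × vertex y ≡ true × x ≢ y
    matched-disjoint  : ∀ {x y x′ y′} → matched x y ≡ true → matched x′ y′ ≡ true →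
                        Overlap x y x′ y′ → x ≡ x′ × y ≡ y′
    member-vertex     : ∀ {z L} → member z L ≡ true → vertex z ≡ true
    member-used       : ∀ {z L} → member z L ≡ true → used L ≡ true
    matched-separated : ∀ {x y L} → matched x y ≡ true → member x L ≡ true → member y L ≡ true → ⊥
    covering          : ∀ {z z′} → z ≢ z′ → vertex z ≡ true → vertex z′ ≡ true →
                        matched z z′ ≡ false → matched z′ z ≡ false →
                        ∃ λ L → member z L ≡ true × member z′ L ≡ true
    unique-block      : ∀ {z z′ L L′} → z ≢ z′ → member z L ≡ true → member z′ L ≡ true →
                        member z L′ ≡ true → member z′ L′ ≡ true → L ≡ L′

  matchingSize : ℕ
  matchingSize = sum λ x → sum λ y → 𝟙 (matched x y)

  usedBlocks : ℕ
  usedBlocks = sum (𝟙 ∘ used)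

module CompleteMinusMatchingBound {n N : ℕ} (𝒫 : PartitionOfCompleteMinusMatching n N) where

  open PartitionOfCompleteMinusMatching 𝒫

  partners : Fin n → Fin n → Bool
  partners q w = matched q w ∨ matched w q

  partner-unique : ∀ {q w w′} → partners q w ≡ true → partners q w′ ≡ true → w ≡ w′
  partner-unique {q} {w} {w′} h h′ with matched q w in e | matched w q in f | matched q w′ in e′ | matched w′ q in f′
  ... | true  | _    | true  | _    = proj₂ (matched-disjoint e e′ (inj₁ refl))
  ... | true  | _    | false | true = let (q≡w′ , w≡q) = matched-disjoint e f′ (inj₂ (inj₁ refl)) in trans w≡q q≡w′
  ... | false | true | true  | _    = let (w≡q , q≡w′) = matched-disjoint f e′ (inj₂ (inj₂ (inj₁ refl))) in trans w≡q q≡w′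
  ... | false | true | false | true = proj₁ (matched-disjoint f f′ (inj₂ (inj₂ (inj₂ refl))))

  partner-count≤1 : ∀ q → sum (λ w → 𝟙 (partners q w)) ≤ 1
  partner-count≤1 q = ∑≤1 _ (λ w → 𝟙≤1 (partners q w))
    (λ w w′ h h′ → partner-unique (1≤𝟙⇒≡true h) (1≤𝟙⇒≡true h′))

  not-partners : ∀ {x z} → partners x z ≡ false → matched x z ≡ false × matched z x ≡ false
  not-partners {x} {z} h with matched x z | matched z x
  ... | false | false = refl , refl

  not-partner-of : ∀ {x y z} → partners x y ≡ true → z ≢ y → partners x z ≡ false
  not-partner-of {x} {y} {z} xy z≢y with partners x z in e
  ... | true  = ⊥-elim (z≢y (partner-unique e xy))
  ... | false = refl

  matching-degree≤1 : ∀ z → sum (λ w → 𝟙 (matched z w)) + sum (λ w → 𝟙 (matched w z)) ≤ 1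
  matching-degree≤1 z = begin
    sum (λ w → 𝟙 (matched z w)) + sum (λ w → 𝟙 (matched w z)) ≡⟨ sym (∑-distrib-+ (λ w → 𝟙 (matched z w)) (λ w → 𝟙 (matched w z))) ⟩
    sum (λ w → 𝟙 (matched z w) + 𝟙 (matched w z))             ≤⟨ ∑-mono-≤ pointwise ⟩
    sum (λ w → 𝟙 (partners z w))                              ≤⟨ partner-count≤1 z ⟩
    1                                                         ∎
    where
    open ≤-Reasoning
    pointwise : ∀ w → 𝟙 (matched z w) + 𝟙 (matched w z) ≤ 𝟙 (partners z w)
    pointwise w with matched z w in e | matched w z in f
    ... | true  | true  = ⊥-elim (proj₂ (proj₂ (matched-vertices e)) (proj₁ (matched-disjoint e f (inj₂ (inj₁ refl)))))
    ... | true  | false = ≤-refl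
    ... | false | true  = ≤-refl
    ... | false | false = z≤n

  another-vertex : ∀ x y → ∃ λ z → vertex z ≡ true × z ≢ x × z ≢ y
  another-vertex x y = let (z , h) = ∑-positive⇒∃ (𝟙 ∘ other) 1≤others in z , other-spec z h
    where
    other : Fin n → Bool
    other z = vertex z ∧ not ⌊ z Fin.≟ x ⌋ ∧ not ⌊ z Fin.≟ y ⌋
    other-spec : ∀ z → 1 ≤ 𝟙 (other z) → vertex z ≡ true × z ≢ x × z ≢ y
    other-spec z h with vertex z | z Fin.≟ x | z Fin.≟ y
    ... | true | no z≢x | no z≢y = refl , z≢x , z≢y
    pointwise : ∀ z → 𝟙 (vertex z) ≤ 𝟙 (other z) + (δ z x + δ z y)
    pointwise z with vertex z | z Fin.≟ x | z Fin.≟ y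
    ... | false | _     | _     = z≤n
    ... | true  | yes _ | _     = s≤s z≤n
    ... | true  | no _  | yes _ = s≤s z≤n
    ... | true  | no _  | no _  = s≤s z≤n
    1≤others : 1 ≤ sum (𝟙 ∘ other)
    1≤others = +-cancelʳ-≤ 2 1 _ (begin
      3                                                        ≤⟨ three-vertices ⟩
      sum (𝟙 ∘ vertex)                                         ≤⟨ ∑-mono-≤ pointwise ⟩
      sum (λ z → 𝟙 (other z) + (δ z x + δ z y))                ≡⟨ ∑-distrib-+ (𝟙 ∘ other) _ ⟩
      sum (𝟙 ∘ other) + sum (λ z → δ z x + δ z y)              ≡⟨ cong (sum (𝟙 ∘ other) +_) (∑-distrib-+ (λ z → δ z x) (λ z → δ z y)) ⟩
      sum (𝟙 ∘ other) + (sum (λ z → δ z x) + sum (λ z → δ z y)) ≡⟨ cong (sum (𝟙 ∘ other) +_) (cong₂ _+_ (∑-δ x) (∑-δ y)) ⟩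
      sum (𝟙 ∘ other) + 2                                      ∎)
      where open ≤-Reasoning

  some-vertex : ∃ λ x → vertex x ≡ true
  some-vertex = let (x , h) = ∑-positive⇒∃ (𝟙 ∘ vertex) (≤-trans (s≤s z≤n) three-vertices) in x , 1≤𝟙⇒≡true h

  unpartnered-pair : ∃ λ x → ∃ λ z → x ≢ z × vertex x ≡ true × vertex z ≡ true × partners x z ≡ false
  unpartnered-pair with some-vertex
  ... | x , vx with another-vertex x x
  ... | z , vz , z≢x , _ with partners x z in e
  ... | false = x , z , ≢-sym z≢x , vx , vz , e
  ... | true  = let (w , vw , w≢x , w≢z) = another-vertex x z in
                x , w , ≢-sym w≢x , vx , vw , not-partner-of e w≢z

  common-block : ∀ {z z′} → z ≢ z′ → vertex z ≡ true → vertex z′ ≡ true → partners z z′ ≡ false →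
                 ∃ λ L → member z L ≡ true × member z′ L ≡ true
  common-block z≢z′ vz vz′ h = let (f , f′) = not-partners h in covering z≢z′ vz vz′ f f′

  size : Fin N → ℕ
  size L = sum λ z → 𝟙 (member z L)

  nonempty-block : ∃ λ L → ∃ λ z → member z L ≡ true
  nonempty-block =
    let (x , z , x≢z , vx , vz , h) = unpartnered-pair
        (L , m , _) = common-block x≢z vx vz h
    in L , x , m

  -- Abstract so that goals mentioning K do not unfold the search for it.
  abstract
    largest-block : ∃ λ K → ∀ L → size L ≤ size K
    largest-block = argmax (proj₁ nonempty-block) size

  K : Fin N
  K = proj₁ largest-block

  k : ℕ
  k = size K

  1≤k : 1 ≤ k
  1≤k = let (L , z , m) = nonempty-block in
        ≤-trans (≤-trans (≡true⇒1≤𝟙 m) (term≤∑ (λ z → 𝟙 (member z L)) z)) (proj₂ largest-block L)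

  K-used : used K ≡ true
  K-used = let (z , h) = ∑-positive⇒∃ (λ z → 𝟙 (member z K)) 1≤k in member-used (1≤𝟙⇒≡true h)

  outsideK : Fin n → Bool
  outsideK z = vertex z ∧ not (member z K)

  outside : ℕ
  outside = sum (𝟙 ∘ outsideK)

  -- Each matched pair has an endpoint outside K, and matched pairs are disjoint.
  matchingSize≤outside : matchingSize ≤ outside
  matchingSize≤outside = begin
    matchingSize
      ≤⟨ ∑-mono-≤ (λ x → ∑-mono-≤ (λ y → endpoint-outside x y)) ⟩
    sum (λ x → sum (λ y → A x y * O x + A x y * O y))
      ≡⟨ sum-cong-≗ (λ x → ∑-distrib-+ (λ y → A x y * O x) (λ y → A x y * O y)) ⟩
    sum (λ x → sum (λ y → A x y * O x) + sum (λ y → A x y * O y))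
      ≡⟨ ∑-distrib-+ (λ x → sum (λ y → A x y * O x)) (λ x → sum (λ y → A x y * O y)) ⟩
    sum (λ x → sum (λ y → A x y * O x)) + sum (λ x → sum (λ y → A x y * O y))
      ≡⟨ cong₂ _+_ (sum-cong-≗ (λ x → ∑-*ʳ (O x) (A x)))
                   (trans (∑-comm (λ x y → A x y * O y)) (sum-cong-≗ (λ y → ∑-*ʳ (O y) (λ x → A x y)))) ⟩
    sum (λ z → sum (A z) * O z) + sum (λ z → sum (λ w → A w z) * O z)
      ≡⟨ sym (∑-distrib-+ (λ z → sum (A z) * O z) (λ z → sum (λ w → A w z) * O z)) ⟩
    sum (λ z → sum (A z) * O z + sum (λ w → A w z) * O z)
      ≡⟨ sum-cong-≗ (λ z → sym (*-distribʳ-+ (O z) (sum (A z)) (sum (λ w → A w z)))) ⟩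
    sum (λ z → (sum (A z) + sum (λ w → A w z)) * O z)
      ≤⟨ ∑-mono-≤ (λ z → *-monoˡ-≤ (O z) (matching-degree≤1 z)) ⟩
    sum (λ z → 1 * O z)
      ≡⟨ sum-cong-≗ (λ z → *-identityˡ (O z)) ⟩
    outside ∎
    where
    open ≤-Reasoning
    A : Fin n → Fin n → ℕ
    A x y = 𝟙 (matched x y)
    O : Fin n → ℕ
    O = 𝟙 ∘ outsideK
    endpoint-outside : ∀ x y → A x y ≤ A x y * O x + A x y * O y
    endpoint-outside x y with matched x y in e
    ... | false = z≤n
    ... | true with matched-vertices e
    ... | vx , vy , _ with member x K in ex | member y K in ey
    ... | true  | true  = ⊥-elim (matched-separated e ex ey)
    ... | false | _     rewrite vx = s≤s z≤n
    ... | true  | false rewrite vx | vy = s≤s z≤n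

  unpartneredOutside : Fin n → ℕ
  unpartneredOutside q = sum λ w → 𝟙 (outsideK w ∧ not (partners q w))

  outside≤unpartneredOutside+1 : ∀ q → outside ≤ unpartneredOutside q + 1
  outside≤unpartneredOutside+1 q = begin
    outside                                                 ≤⟨ ∑-mono-≤ pointwise ⟩
    sum (λ w → 𝟙 (outsideK w ∧ not (partners q w)) + 𝟙 (partners q w))
      ≡⟨ ∑-distrib-+ (λ w → 𝟙 (outsideK w ∧ not (partners q w))) (λ w → 𝟙 (partners q w)) ⟩
    unpartneredOutside q + sum (λ w → 𝟙 (partners q w))     ≤⟨ +-monoʳ-≤ (unpartneredOutside q) (partner-count≤1 q) ⟩
    unpartneredOutside q + 1                                ∎
    where
    open ≤-Reasoning
    pointwise : ∀ w → 𝟙 (outsideK w) ≤ 𝟙 (outsideK w ∧ not (partners q w)) + 𝟙 (partners q w)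
    pointwise w with outsideK w | partners q w
    ... | true  | true  = s≤s z≤n
    ... | true  | false = s≤s z≤n
    ... | false | _     = z≤n

  pairsFromK : ℕ
  pairsFromK = sum λ q → 𝟙 (member q K) * unpartneredOutside q

  -- Double counting, from the side of K: each q ∈ K has at most one partner.
  k*outside≤pairsFromK+k : k * outside ≤ pairsFromK + k
  k*outside≤pairsFromK+k = begin
    k * outside                                                ≡⟨ sym (∑-*ʳ outside (λ q → 𝟙 (member q K))) ⟩
    sum (λ q → 𝟙 (member q K) * outside)                       ≤⟨ ∑-mono-≤ (λ q → *-monoʳ-≤ (𝟙 (member q K)) (outside≤unpartneredOutside+1 q)) ⟩
    sum (λ q → 𝟙 (member q K) * (unpartneredOutside q + 1))    ≡⟨ sum-cong-≗ distrib ⟩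
    sum (λ q → 𝟙 (member q K) * unpartneredOutside q + 𝟙 (member q K))
      ≡⟨ ∑-distrib-+ (λ q → 𝟙 (member q K) * unpartneredOutside q) (λ q → 𝟙 (member q K)) ⟩
    pairsFromK + k                                             ∎
    where
    open ≤-Reasoning
    distrib : ∀ q → 𝟙 (member q K) * (unpartneredOutside q + 1) ≡ 𝟙 (member q K) * unpartneredOutside q + 𝟙 (member q K)
    distrib q = trans (*-distribˡ-+ (𝟙 (member q K)) (unpartneredOutside q) 1)
                      (cong (𝟙 (member q K) * unpartneredOutside q +_) (*-identityʳ (𝟙 (member q K))))

  meetsK : Fin n → Fin N → ℕ
  meetsK q L = 𝟙 (member q K ∧ member q L)

  missesK : Fin n → Fin N → ℕ
  missesK w L = 𝟙 (not (member w K) ∧ member w L)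

  insideK : Fin N → ℕ
  insideK L = sum λ q → meetsK q L

  beyondK : Fin N → ℕ
  beyondK L = sum λ w → missesK w L

  pair-in-some-block : ∀ q w → 𝟙 (member q K) * 𝟙 (outsideK w ∧ not (partners q w)) ≤ sum (λ L → meetsK q L * missesK w L)
  pair-in-some-block q w with member q K in qK | vertex w in vw | member w K in wK | partners q w in qw
  ... | false | _     | _     | _     = z≤n
  ... | true  | false | _     | _     = z≤n
  ... | true  | true  | true  | _     = z≤n
  ... | true  | true  | false | true  = z≤n
  ... | true  | true  | false | false with common-block q≢w (member-vertex qK) vw qw
    where
    q≢w : q ≢ w
    q≢w refl = true≢false (trans (sym qK) wK)
  ... | L , qL , wL = ≤-trans (≤-reflexive one) (term≤∑ (λ L → 𝟙 (member q L) * 𝟙 (member w L)) L)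
    where
    one : 1 ≡ 𝟙 (member q L) * 𝟙 (member w L)
    one rewrite qL | wL = refl

  pairsFromK≤∑insideK*beyondK : pairsFromK ≤ sum (λ L → insideK L * beyondK L)
  pairsFromK≤∑insideK*beyondK = begin
    pairsFromK
      ≡⟨ sum-cong-≗ (λ q → sym (∑-*ˡ (𝟙 (member q K)) (λ w → 𝟙 (outsideK w ∧ not (partners q w))))) ⟩
    sum (λ q → sum (λ w → 𝟙 (member q K) * 𝟙 (outsideK w ∧ not (partners q w))))
      ≤⟨ ∑-mono-≤ (λ q → ∑-mono-≤ (λ w → pair-in-some-block q w)) ⟩
    sum (λ q → sum (λ w → sum (λ L → meetsK q L * missesK w L)))
      ≡⟨ sum-cong-≗ (λ q → ∑-comm (λ w L → meetsK q L * missesK w L)) ⟩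
    sum (λ q → sum (λ L → sum (λ w → meetsK q L * missesK w L)))
      ≡⟨ ∑-comm (λ q L → sum (λ w → meetsK q L * missesK w L)) ⟩
    sum (λ L → sum (λ q → sum (λ w → meetsK q L * missesK w L)))
      ≡⟨ sum-cong-≗ (λ L → trans (sum-cong-≗ (λ q → ∑-*ˡ (meetsK q L) (λ w → missesK w L)))
                                 (∑-*ʳ (beyondK L) (λ q → meetsK q L))) ⟩
    sum (λ L → insideK L * beyondK L) ∎
    where open ≤-Reasoning

  insideK≤1 : ∀ {L} → L ≢ K → insideK L ≤ 1
  insideK≤1 {L} L≢K = ∑≤1 (λ q → meetsK q L) (λ q → 𝟙≤1 _) same
    where
    same : ∀ q q′ → 1 ≤ meetsK q L → 1 ≤ meetsK q′ L → q ≡ q′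
    same q q′ h h′ with q Fin.≟ q′
    ... | yes q≡q′ = q≡q′
    ... | no q≢q′ =
      let (qK , qL) = ∧-elim (1≤𝟙⇒≡true h)
          (q′K , q′L) = ∧-elim (1≤𝟙⇒≡true h′)
      in ⊥-elim (L≢K (unique-block q≢q′ qL q′L qK q′K))

  beyondK≡0 : beyondK K ≡ 0
  beyondK≡0 = ∑-zero (λ w → missesK w K) pointwise
    where
    pointwise : ∀ w → missesK w K ≡ 0
    pointwise w with member w K
    ... | true  = refl
    ... | false = refl

  beyondK≤k∸1 : ∀ {q L} → member q K ≡ true → member q L ≡ true → beyondK L ≤ k ∸ 1
  beyondK≤k∸1 {q} {L} qK qL = ≤-trans (≤-reflexive (sym (m+n∸n≡m (beyondK L) 1)))
                                      (∸-monoˡ-≤ 1 (≤-trans beyondK+1≤size (proj₂ largest-block L)))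
    where
    pointwise : ∀ w → missesK w L + δ w q ≤ 𝟙 (member w L)
    pointwise w with w Fin.≟ q
    ... | yes refl rewrite qK | qL = ≤-refl
    ... | no _ with member w K | member w L
    ... | true  | _     = z≤n
    ... | false | true  = ≤-refl
    ... | false | false = z≤n
    beyondK+1≤size : beyondK L + 1 ≤ size L
    beyondK+1≤size = begin
      beyondK L + 1                                ≡⟨ cong (beyondK L +_) (sym (∑-δ q)) ⟩
      beyondK L + sum (λ w → δ w q)                ≡⟨ sym (∑-distrib-+ (λ w → missesK w L) (λ w → δ w q)) ⟩
      sum (λ w → missesK w L + δ w q)              ≤⟨ ∑-mono-≤ pointwise ⟩
      size L                                       ∎
      where open ≤-Reasoning

  insideK*beyondK≤ : ∀ {L} → L ≢ K → insideK L * beyondK L ≤ (k ∸ 1) * 𝟙 (used L)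
  insideK*beyondK≤ {L} L≢K with insideK L in e | insideK≤1 L≢K
  ... | zero     | _ = z≤n
  ... | suc (suc _) | s≤s ()
  ... | suc zero | _ =
    let (q , h) = ∑-positive⇒∃ (λ q → meetsK q L) (≤-reflexive (sym e))
        (qK , qL) = ∧-elim (1≤𝟙⇒≡true h)
    in subst₂ _≤_ (sym (+-identityʳ (beyondK L)))
              (sym (trans (cong (λ b → (k ∸ 1) * 𝟙 b) (member-used qL)) (*-identityʳ (k ∸ 1))))
              (beyondK≤k∸1 qK qL)

  -- A block L ≢ K meets K at most once and has at most k − 1 vertices outside K;
  -- K itself only contributes its δ-term.
  block-bound : ∀ L → insideK L * beyondK L + (k ∸ 1) * δ L K ≤ (k ∸ 1) * 𝟙 (used L)
  block-bound L = by-cases (L Fin.≟ K)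
    where
    by-cases : Dec (L ≡ K) → insideK L * beyondK L + (k ∸ 1) * δ L K ≤ (k ∸ 1) * 𝟙 (used L)
    by-cases (yes refl) = ≤-reflexive (begin
      insideK K * beyondK K + (k ∸ 1) * δ K K ≡⟨ cong₂ (λ b d → insideK K * b + (k ∸ 1) * d) beyondK≡0 (δ-refl K) ⟩
      insideK K * 0 + (k ∸ 1) * 1             ≡⟨ cong (λ m → m + (k ∸ 1) * 1) (*-zeroʳ (insideK K)) ⟩
      (k ∸ 1) * 1                             ≡⟨ cong (λ b → (k ∸ 1) * 𝟙 b) (sym K-used) ⟩
      (k ∸ 1) * 𝟙 (used K)                    ∎)
      where open ≡-Reasoning
    by-cases (no L≢K) = begin
      insideK L * beyondK L + (k ∸ 1) * δ L K ≡⟨ cong (λ d → insideK L * beyondK L + (k ∸ 1) * d) (δ-≢ L≢K) ⟩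
      insideK L * beyondK L + (k ∸ 1) * 0     ≡⟨ cong (insideK L * beyondK L +_) (*-zeroʳ (k ∸ 1)) ⟩
      insideK L * beyondK L + 0               ≡⟨ +-identityʳ (insideK L * beyondK L) ⟩
      insideK L * beyondK L                   ≤⟨ insideK*beyondK≤ L≢K ⟩
      (k ∸ 1) * 𝟙 (used L)                    ∎
      where open ≤-Reasoning

  ∑insideK*beyondK+k∸1≤ : sum (λ L → insideK L * beyondK L) + (k ∸ 1) ≤ (k ∸ 1) * usedBlocks
  ∑insideK*beyondK+k∸1≤ = begin
    sum (λ L → insideK L * beyondK L) + (k ∸ 1)
      ≡⟨ cong (sum (λ L → insideK L * beyondK L) +_) (sym (trans (∑-*ˡ (k ∸ 1) (λ L → δ L K))
                                                        (trans (cong ((k ∸ 1) *_) (∑-δ K)) (*-identityʳ (k ∸ 1))))) ⟩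
    sum (λ L → insideK L * beyondK L) + sum (λ L → (k ∸ 1) * δ L K)
      ≡⟨ sym (∑-distrib-+ (λ L → insideK L * beyondK L) (λ L → (k ∸ 1) * δ L K)) ⟩
    sum (λ L → insideK L * beyondK L + (k ∸ 1) * δ L K)
      ≤⟨ ∑-mono-≤ block-bound ⟩
    sum (λ L → (k ∸ 1) * 𝟙 (used L))
      ≡⟨ ∑-*ˡ (k ∸ 1) (𝟙 ∘ used) ⟩
    (k ∸ 1) * usedBlocks ∎
    where open ≤-Reasoning

  matched⇒partners : ∀ {x y} → matched x y ≡ true → partners x y ≡ true × partners y x ≡ true
  matched⇒partners {x} {y} xy = cong (_∨ matched y x) xy , trans (cong (matched y x ∨_) xy) (∨-zeroʳ (matched y x))

  two-used-blocks : 1 ≤ matchingSize → 2 ≤ usedBlocks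
  two-used-blocks h with ∑-positive⇒∃ (λ x → sum (λ y → 𝟙 (matched x y))) h
  ... | x , hx with ∑-positive⇒∃ (λ y → 𝟙 (matched x y)) hx
  ... | y , hy with 1≤𝟙⇒≡true hy
  ... | xy with matched-vertices xy | matched⇒partners xy | another-vertex x y
  ... | vx , vy , _ | xy-partners , yx-partners | z , vz , z≢x , z≢y
    with common-block (≢-sym z≢x) vx vz (not-partner-of xy-partners z≢y)
       | common-block (≢-sym z≢y) vy vz (not-partner-of yx-partners z≢x)
  ... | L , xL , _ | L′ , yL′ , _ =
    2≤∑ (𝟙 ∘ used) L≢L′ (≡true⇒1≤𝟙 (member-used xL)) (≡true⇒1≤𝟙 (member-used yL′))
    where
    L≢L′ : L ≢ L′
    L≢L′ refl = matched-separated xy xL yL′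

  few-outside : matchingSize ≤ 1 → matchingSize + 1 ≤ usedBlocks
  few-outside a≤1 with matchingSize in e | a≤1
  ... | zero        | _        = ≤-trans (≡true⇒1≤𝟙 K-used) (term≤∑ (𝟙 ∘ used) K)
  ... | suc zero    | _        = two-used-blocks (≤-reflexive (sym e))
  ... | suc (suc _) | s≤s ()

  matchingSize+1≤usedBlocks : matchingSize + 1 ≤ usedBlocks
  matchingSize+1≤usedBlocks with 2 ≤? outside
  ... | yes 2≤o = ≤-trans (+-monoˡ-≤ 1 matchingSize≤outside)
                          (outside<blocks k outside pairsFromK usedBlocks 1≤k 2≤o
                             k*outside≤pairsFromK+k
                             (≤-trans (+-monoˡ-≤ (k ∸ 1) pairsFromK≤∑insideK*beyondK) ∑insideK*beyondK+k∸1≤))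
  ... | no o≱2 = few-outside (≤-trans matchingSize≤outside (≤-pred (≰⇒> o≱2)))

-- Edges, wings and the cliques of the line graph

module Adjacency {n : ℕ} (G : SimpleGraph n) where

  adj-flip : ∀ {a b} → adj G a b ≡ true → adj G b a ≡ true
  adj-flip {a} {b} h = trans (adj-sym G b a) h

  adj⇒≢ : ∀ {a b} → adj G a b ≡ true → a ≢ b
  adj⇒≢ {a} h refl = true≢false (trans (sym h) (irrfl G a))

  3≤degree : ∀ {u p q r} → adj G u p ≡ true → adj G u q ≡ true → adj G u r ≡ true →
             p ≢ q → p ≢ r → q ≢ r → 3 ≤ degree G u
  3≤degree {u} up uq ur p≢q p≢r q≢r =
    subst (3 ≤_) (sym (sum-allFin n (𝟙 ∘ adj G u)))
      (3≤∑ (𝟙 ∘ adj G u) p≢q p≢r q≢r (≡true⇒1≤𝟙 up) (≡true⇒1≤𝟙 uq) (≡true⇒1≤𝟙 ur))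

  degree-2-neighbours : ∀ {u p q r} → degree G u ≡ 2 → adj G u p ≡ true → adj G u q ≡ true → adj G u r ≡ true →
                        p ≢ q → p ≢ r → q ≡ r
  degree-2-neighbours {q = q} {r} d≡2 up uq ur p≢q p≢r with q Fin.≟ r
  ... | yes q≡r = q≡r
  ... | no q≢r = ⊥-elim (<-irrefl (sym d≡2) (3≤degree up uq ur p≢q p≢r q≢r))

module _ {n : ℕ} {G : SimpleGraph n} where

  open Adjacency G

  data Joins (e : Edge G) (a b : Fin n) : Set where
    forward  : lo e ≡ a → hi e ≡ b → Joins e a b
    backward : lo e ≡ b → hi e ≡ a → Joins e a b

  joins? : ∀ e a b → Dec (Joins e a b)
  joins? e a b = map′ from-⊎ to-⊎ ((lo e Fin.≟ a ×-dec hi e Fin.≟ b) ⊎-dec (lo e Fin.≟ b ×-dec hi e Fin.≟ a))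
    where
    from-⊎ : (lo e ≡ a × hi e ≡ b) ⊎ (lo e ≡ b × hi e ≡ a) → Joins e a b
    from-⊎ (inj₁ (p , q)) = forward p q
    from-⊎ (inj₂ (p , q)) = backward p q
    to-⊎ : Joins e a b → (lo e ≡ a × hi e ≡ b) ⊎ (lo e ≡ b × hi e ≡ a)
    to-⊎ (forward p q)  = inj₁ (p , q)
    to-⊎ (backward p q) = inj₂ (p , q)

  Joins-sym : ∀ {e a b} → Joins e a b → Joins e b a
  Joins-sym (forward p q)  = backward p q
  Joins-sym (backward p q) = forward p q

  Joins⇒adj : ∀ {e a b} → Joins e a b → adj G a b ≡ true
  Joins⇒adj {e} (forward refl refl)  = isAdj e
  Joins⇒adj {e} (backward refl refl) = adj-flip (isAdj e)

  edge-≡ : ∀ {e f : Edge G} → lo e ≡ lo f → hi e ≡ hi f → e ≡ f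
  edge-≡ {edge l h p q} {edge .l .h p′ q′} refl refl
    rewrite Decidable⇒UIP.≡-irrelevant Bool._≟_ p p′ | Decidable⇒UIP.≡-irrelevant Bool._≟_ q q′ = refl

  toℕ-lo<hi : ∀ (e : Edge G) → toℕ (lo e) < toℕ (hi e)
  toℕ-lo<hi e = <ᵇ⇒< (toℕ (lo e)) (toℕ (hi e)) (Equivalence.from T-≡ (lo<hi e))

  Joins-endpoints : ∀ {e a b c d} → Joins e a b → Joins e c d → (a ≡ c × b ≡ d) ⊎ (a ≡ d × b ≡ c)
  Joins-endpoints (forward refl refl)  (forward p q)  = inj₁ (p , q)
  Joins-endpoints (forward refl refl)  (backward p q) = inj₂ (p , q)
  Joins-endpoints (backward refl refl) (forward p q)  = inj₂ (q , p)
  Joins-endpoints (backward refl refl) (backward p q) = inj₁ (q , p)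

  -- Edges are stored with lo < hi, so the edge joining a and b is unique.
  Joins-unique : ∀ {e f a b} → Joins e a b → Joins f a b → e ≡ f
  Joins-unique (forward p q)  (forward r s)  = edge-≡ (trans p (sym r)) (trans q (sym s))
  Joins-unique (backward p q) (backward r s) = edge-≡ (trans p (sym r)) (trans q (sym s))
  Joins-unique {e} {f} (forward refl refl) (backward r s) =
    ⊥-elim (<-asym (toℕ-lo<hi e) (subst₂ (λ a b → toℕ a < toℕ b) r s (toℕ-lo<hi f)))
  Joins-unique {e} {f} (backward refl refl) (forward r s) =
    ⊥-elim (<-asym (toℕ-lo<hi e) (subst₂ (λ a b → toℕ a < toℕ b) r s (toℕ-lo<hi f)))

  edge-joining : ∀ {a b} → adj G a b ≡ true → ∃ λ e → Joins e a b
  edge-joining {a} {b} h with <-cmp (toℕ a) (toℕ b)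
  ... | tri< a<b _ _ = edge a b (Equivalence.to T-≡ (<⇒<ᵇ a<b)) h , forward refl refl
  ... | tri≈ _ a≡b _ = ⊥-elim (adj⇒≢ h (Finₚ.toℕ-injective a≡b))
  ... | tri> _ _ b<a = edge b a (Equivalence.to T-≡ (<⇒<ᵇ b<a)) (adj-flip h) , backward refl refl

  Joins-Overlap : ∀ {e f a b c d} → Joins e a b → Joins f c d →
                  Overlap (lo e) (hi e) (lo f) (hi f) → Overlap a b c d
  Joins-Overlap (forward refl refl)  (forward refl refl)  o = o
  Joins-Overlap (forward refl refl)  (backward refl refl) o = Overlap-swapʳ o
  Joins-Overlap (backward refl refl) (forward refl refl)  o = Overlap-swapˡ o
  Joins-Overlap (backward refl refl) (backward refl refl) o = Overlap-swapˡ (Overlap-swapʳ o)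

  Overlap-Joins : ∀ {e f a b c d} → Joins e a b → Joins f c d →
                  Overlap a b c d → Overlap (lo e) (hi e) (lo f) (hi f)
  Overlap-Joins (forward refl refl)  (forward refl refl)  o = o
  Overlap-Joins (forward refl refl)  (backward refl refl) o = Overlap-swapʳ o
  Overlap-Joins (backward refl refl) (forward refl refl)  o = Overlap-swapˡ o
  Overlap-Joins (backward refl refl) (backward refl refl) o = Overlap-swapˡ (Overlap-swapʳ o)

  _≟ₑ_ : (e f : Edge G) → Dec (e ≡ f)
  e ≟ₑ f with lo e Fin.≟ lo f | hi e Fin.≟ hi f
  ... | yes p | yes q = yes (edge-≡ p q)
  ... | no ¬p | _     = no (¬p ∘ cong lo)
  ... | yes _ | no ¬q = no (¬q ∘ cong hi)

  LineAdj⇒Overlap : ∀ {e f a b c d} → LineAdj G e f → Joins e a b → Joins f c d → Overlap a b c d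
  LineAdj⇒Overlap (_ , o) je jf = Joins-Overlap je jf o

  LineAdj-at : ∀ {e f a b c} → Joins e a b → Joins f a c → b ≢ c → LineAdj G e f
  LineAdj-at {e} {f} je jf b≢c = e≢f , Overlap-Joins je jf (inj₁ refl)
    where
    e≢f : e ≢ f
    e≢f refl with Joins-endpoints je jf
    ... | inj₁ (_ , b≡c)   = b≢c b≡c
    ... | inj₂ (a≡c , b≡a) = b≢c (trans b≡a a≡c)


module Wings {n : ℕ} (G : SimpleGraph n) (v : Fin n) where

  open Adjacency G

  record Wing (x y : Fin n) : Set where
    field
      x<y        : toℕ x < toℕ y
      v~x        : adj G v x ≡ true
      v~y        : adj G v y ≡ true
      x~y        : adj G x y ≡ true
      degree-x≡2 : degree G x ≡ 2
      degree-y≡2 : degree G y ≡ 2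
      2<degree-v : 2 < degree G v
  open Wing public

  isWing⇒Wing : ∀ {x y} → isWing G v x y ≡ true → Wing x y
  isWing⇒Wing {x} {y} h =
    let (h₁ , r₁) = ∧-elim {toℕ x <ᵇ toℕ y} h
        (h₂ , r₂) = ∧-elim {adj G v x} r₁
        (h₃ , r₃) = ∧-elim {adj G v y} r₂
        (h₄ , r₄) = ∧-elim {adj G x y} r₃
        (h₅ , r₅) = ∧-elim {degree G x ≡ᵇ 2} r₄
        (h₆ , h₇) = ∧-elim {degree G y ≡ᵇ 2} r₅
    in record { x<y = <ᵇ⇒< _ _ (T-of h₁) ; v~x = h₂ ; v~y = h₃ ; x~y = h₄
              ; degree-x≡2 = ≡ᵇ⇒≡ _ _ (T-of h₅) ; degree-y≡2 = ≡ᵇ⇒≡ _ _ (T-of h₆)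
              ; 2<degree-v = <ᵇ⇒< _ _ (T-of h₇) }
    where
    T-of : ∀ {b} → b ≡ true → T b
    T-of = Equivalence.from T-≡

  -- The ends of a wing have degree 2, so their only neighbours are v and each other.
  wings-disjoint : ∀ {x y x′ y′} → Wing x y → Wing x′ y′ → Overlap x y x′ y′ → x ≡ x′ × y ≡ y′
  wings-disjoint w w′ (inj₁ refl) =
    refl , degree-2-neighbours (degree-x≡2 w) (adj-flip (v~x w)) (x~y w) (x~y w′) (adj⇒≢ (v~y w)) (adj⇒≢ (v~y w′))
  wings-disjoint {x} {y} {x′} w w′ (inj₂ (inj₁ refl)) =
    ⊥-elim (<-asym (subst (λ z → toℕ x < toℕ z) y≡x′ (x<y w)) (x<y w′))
    where
    y≡x′ : y ≡ x′
    y≡x′ = degree-2-neighbours (degree-x≡2 w) (adj-flip (v~x w)) (x~y w) (adj-flip (x~y w′)) (adj⇒≢ (v~y w)) (adj⇒≢ (v~x w′))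
  wings-disjoint {x} {y} {y′ = y′} w w′ (inj₂ (inj₂ (inj₁ refl))) =
    ⊥-elim (<-asym (subst (λ z → toℕ z < toℕ y) x≡y′ (x<y w)) (x<y w′))
    where
    x≡y′ : x ≡ y′
    x≡y′ = degree-2-neighbours (degree-y≡2 w) (adj-flip (v~y w)) (adj-flip (x~y w)) (x~y w′) (adj⇒≢ (v~x w)) (adj⇒≢ (v~y w′))
  wings-disjoint w w′ (inj₂ (inj₂ (inj₂ refl))) =
    degree-2-neighbours (degree-y≡2 w) (adj-flip (v~y w)) (adj-flip (x~y w)) (adj-flip (x~y w′)) (adj⇒≢ (v~x w)) (adj⇒≢ (v~x w′)) , refl

module CliquesAtAStalk {n : ℕ} (G : SimpleGraph n) (P : List (List (Edge G)))
                       (ecp : EdgeCliquePartition G P) (v : Fin n) where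

  open EdgeCliquePartition ecp
  open Adjacency G
  open Wings G v

  N : ℕ
  N = length P

  contains : Fin N → Fin n → Fin n → Bool
  contains L a b = does (any? (λ e → joins? e a b) (lookup P L))

  contains-sound : ∀ {L a b} → contains L a b ≡ true → ∃ λ e → e ∈ lookup P L × Joins e a b
  contains-sound {L} {a} {b} h = find (does⇒ (any? (λ e → joins? e a b) (lookup P L)) h)

  contains-complete : ∀ {L a b e} → e ∈ lookup P L → Joins e a b → contains L a b ≡ true
  contains-complete {L} {a} {b} e∈L j = dec-true (any? (λ e → joins? e a b) (lookup P L)) (lose e∈L j)

  same-clique : ∀ {a b c d L L′} → (∀ {e f} → Joins e a b → Joins f c d → LineAdj G e f) →
                contains L a b ≡ true → contains L c d ≡ true →
                contains L′ a b ≡ true → contains L′ c d ≡ true → L ≡ L′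
  same-clique {L = L} {L′} adjacent h₁ h₂ h₃ h₄
    with contains-sound h₁ | contains-sound h₂ | contains-sound h₃ | contains-sound h₄
  ... | e , e∈L , je | f , f∈L , jf | e′ , e′∈L′ , je′ | f′ , f′∈L′ , jf′ =
    unique1 e f (adjacent je jf) L L′ e∈L f∈L
      (subst (_∈ lookup P L′) (Joins-unique je′ je) e′∈L′) (subst (_∈ lookup P L′) (Joins-unique jf′ jf) f′∈L′)

  common-clique : ∀ {a b c} → adj G a b ≡ true → adj G a c ≡ true → b ≢ c →
                  ∃ λ L → contains L a b ≡ true × contains L a c ≡ true
  common-clique ab ac b≢c with edge-joining ab | edge-joining ac
  ... | e , je | f , jf with exists1 e f (LineAdj-at je jf b≢c)
  ... | L , e∈L , f∈L = L , contains-complete e∈L je , contains-complete f∈L jf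

  -- A clique of G* through the edge xy of a wing consists of edges at x or y.
  wing-clique-neighbours : ∀ {x y z L} → Wing x y → contains L x y ≡ true → contains L v z ≡ true → z ≡ x ⊎ z ≡ y
  wing-clique-neighbours {L = L} w hxy hvz with contains-sound hxy | contains-sound hvz
  ... | g , g∈L , jg | e , e∈L , je with LineAdj⇒Overlap (cliques L e∈L g∈L e≢g) je jg
    where
    e≢g : e ≢ g
    e≢g refl with Joins-endpoints je jg
    ... | inj₁ (v≡x , _) = adj⇒≢ (v~x w) v≡x
    ... | inj₂ (v≡y , _) = adj⇒≢ (v~y w) v≡y
  ... | inj₁ v≡x               = ⊥-elim (adj⇒≢ (v~x w) v≡x)
  ... | inj₂ (inj₁ v≡y)        = ⊥-elim (adj⇒≢ (v~y w) v≡y)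
  ... | inj₂ (inj₂ (inj₁ z≡x)) = inj₁ z≡x
  ... | inj₂ (inj₂ (inj₂ z≡y)) = inj₂ z≡y

  one-wing-per-clique : ∀ {x y x′ y′ L} → Wing x y → Wing x′ y′ →
                        contains L x y ≡ true → contains L x′ y′ ≡ true → x ≡ x′ × y ≡ y′
  one-wing-per-clique {L = L} w w′ h h′ with contains-sound h | contains-sound h′
  ... | g , g∈L , jg | g′ , g′∈L , jg′ with g ≟ₑ g′
  ... | no g≢g′ = wings-disjoint w w′ (LineAdj⇒Overlap (cliques L g∈L g′∈L g≢g′) jg jg′)
  ... | yes refl with Joins-endpoints jg jg′
  ...   | inj₁ same         = same
  ...   | inj₂ (x≡y′ , _)   = wings-disjoint w w′ (inj₂ (inj₁ x≡y′))

  wing : Fin n → Fin n → Bool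
  wing = isWing G v

  wingEdgesIn : Fin N → ℕ
  wingEdgesIn L = sum λ x → sum λ y → 𝟙 (wing x y ∧ contains L x y)

  wingEdgesIn≤1 : ∀ L → wingEdgesIn L ≤ 1
  wingEdgesIn≤1 L = ∑≤1 (λ x → sum (wingEdge x)) row≤1 (λ x x′ h h′ →
      let (y , hy) = ∑-positive⇒∃ (wingEdge x) h
          (y′ , hy′) = ∑-positive⇒∃ (wingEdge x′) h′
      in proj₁ (same-wing x y x′ y′ hy hy′))
    where
    wingEdge : Fin n → Fin n → ℕ
    wingEdge x y = 𝟙 (wing x y ∧ contains L x y)
    same-wing : ∀ x y x′ y′ → 1 ≤ wingEdge x y → 1 ≤ wingEdge x′ y′ → x ≡ x′ × y ≡ y′
    same-wing x y x′ y′ h h′ with ∧-elim {wing x y} (1≤𝟙⇒≡true h) | ∧-elim {wing x′ y′} (1≤𝟙⇒≡true h′)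
    ... | w , c | w′ , c′ = one-wing-per-clique (isWing⇒Wing w) (isWing⇒Wing w′) c c′
    row≤1 : ∀ x → sum (wingEdge x) ≤ 1
    row≤1 x = ∑≤1 (wingEdge x) (λ y → 𝟙≤1 _) (λ y y′ h h′ → proj₂ (same-wing x y x y′ h h′))

  wingFree : Fin N → Bool
  wingFree L = wingEdgesIn L ≡ᵇ 0

  wing-not-free : ∀ {x y L} → wing x y ≡ true → contains L x y ≡ true → wingFree L ≡ false
  wing-not-free {x} {y} {L} w c = positive (≤-trans (≤-trans (≡true⇒1≤𝟙 (cong₂ _∧_ w c))
      (term≤∑ (λ y → 𝟙 (wing x y ∧ contains L x y)) y)) (term≤∑ (λ x → sum (λ y → 𝟙 (wing x y ∧ contains L x y))) x))
    where
    positive : ∀ {m} → 1 ≤ m → (m ≡ᵇ 0) ≡ false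
    positive (s≤s _) = refl

  Triangle : Fin N → Fin n → Fin n → Set
  Triangle L x y = contains L v x ≡ true × contains L v y ≡ true × contains L x y ≡ true

  triangular : Fin n → Fin n → Bool
  triangular x y = does (Finₚ.any? (λ L → (contains L v x ∧ contains L v y ∧ contains L x y) Bool.≟ true))

  triangular-sound : ∀ {x y} → triangular x y ≡ true → ∃ λ L → Triangle L x y
  triangular-sound {x} {y} h with does⇒ (Finₚ.any? (λ L → (contains L v x ∧ contains L v y ∧ contains L x y) Bool.≟ true)) h
  ... | L , t with ∧-elim {contains L v x} t
  ... | vx , r = L , vx , ∧-elim r

  triangular-complete : ∀ {x y L} → Triangle L x y → triangular x y ≡ true
  triangular-complete {x} {y} {L} (vx , vy , xy) =
    dec-true (Finₚ.any? (λ L → (contains L v x ∧ contains L v y ∧ contains L x y) Bool.≟ true))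
             (L , cong₂ _∧_ vx (cong₂ _∧_ vy xy))

  matched : Fin n → Fin n → Bool
  matched x y = wing x y ∧ triangular x y

  matched⇒Wing : ∀ {x y} → matched x y ≡ true → Wing x y
  matched⇒Wing {x} {y} h = isWing⇒Wing (proj₁ (∧-elim {wing x y} h))

  member : Fin n → Fin N → Bool
  member z L = contains L v z ∧ wingFree L

  member⇒contains : ∀ {z L} → member z L ≡ true → contains L v z ≡ true
  member⇒contains {z} {L} h = proj₁ (∧-elim {contains L v z} h)

  -- A wing edge xy in a clique through vz and vz′ forces {z, z′} = {x, y}, and then vx, vy, xy form a triangle.
  wingFree-through : ∀ {z z′ L} → z ≢ z′ → contains L v z ≡ true → contains L v z′ ≡ true →
                     matched z z′ ≡ false → matched z′ z ≡ false → wingFree L ≡ true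
  wingFree-through {z} {z′} {L} z≢z′ vz vz′ f f′ =
    cong (_≡ᵇ 0) (∑-zero (λ x → sum (λ y → 𝟙 (wing x y ∧ contains L x y)))
                         (λ x → ∑-zero (λ y → 𝟙 (wing x y ∧ contains L x y)) (no-wing-edge x)))
    where
    no-wing-edge : ∀ x y → 𝟙 (wing x y ∧ contains L x y) ≡ 0
    no-wing-edge x y with wing x y in w | contains L x y in c
    ... | false | _     = refl
    ... | true  | false = refl
    ... | true  | true with wing-clique-neighbours (isWing⇒Wing w) c vz | wing-clique-neighbours (isWing⇒Wing w) c vz′
    ... | inj₁ z≡x  | inj₁ z′≡x = ⊥-elim (z≢z′ (trans z≡x (sym z′≡x)))
    ... | inj₂ z≡y  | inj₂ z′≡y = ⊥-elim (z≢z′ (trans z≡y (sym z′≡y)))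
    ... | inj₁ refl | inj₂ refl = ⊥-elim (true≢false (trans (sym (cong₂ _∧_ w (triangular-complete (vz , vz′ , c)))) f))
    ... | inj₂ refl | inj₁ refl = ⊥-elim (true≢false (trans (sym (cong₂ _∧_ w (triangular-complete (vz′ , vz , c)))) f′))

  -- The triangle clique of a matched pair x, y is the only clique through vx and vy, and it is not wing-free.
  matched-separated : ∀ {x y L} → matched x y ≡ true → member x L ≡ true → member y L ≡ true → ⊥
  matched-separated {x} {y} {L} h hx hy with ∧-elim {wing x y} h
  ... | w , t with triangular-sound t
  ... | L₀ , vx₀ , vy₀ , xy₀ = true≢false (trans (sym (proj₂ (∧-elim {contains L v x} hx))) (wing-not-free w xy))
    where
    L≡L₀ : L ≡ L₀
    L≡L₀ = same-clique (λ je jf → LineAdj-at je jf (adj⇒≢ (x~y (isWing⇒Wing w))))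
                       (member⇒contains hx) (member⇒contains hy) vx₀ vy₀
    xy : contains L x y ≡ true
    xy = subst (λ M → contains M x y ≡ true) (sym L≡L₀) xy₀

  stalkPartition : ∀ {x₀ y₀} → Wing x₀ y₀ → PartitionOfCompleteMinusMatching n N
  stalkPartition w₀ = record
    { vertex            = adj G v
    ; matched           = matched
    ; member            = member
    ; used              = wingFree
    ; three-vertices    = subst (3 ≤_) (sum-allFin n (𝟙 ∘ adj G v)) (2<degree-v w₀)
    ; matched-vertices  = λ h → let w = matched⇒Wing h in v~x w , v~y w , adj⇒≢ (x~y w)
    ; matched-disjoint  = λ h h′ → wings-disjoint (matched⇒Wing h) (matched⇒Wing h′)
    ; member-vertex     = λ h → let (_ , _ , j) = contains-sound (member⇒contains h) in Joins⇒adj j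
    ; member-used       = λ {z} {L} h → proj₂ (∧-elim {contains L v z} h)
    ; matched-separated = matched-separated
    ; covering          = λ z≢z′ vz vz′ f f′ →
        let (L , c , c′) = common-clique vz vz′ z≢z′
            free = wingFree-through z≢z′ c c′ f f′
        in L , cong₂ _∧_ c free , cong₂ _∧_ c′ free
    ; unique-block      = λ z≢z′ h₁ h₂ h₃ h₄ → same-clique (λ je jf → LineAdj-at je jf z≢z′)
        (member⇒contains h₁) (member⇒contains h₂) (member⇒contains h₃) (member⇒contains h₄)
    }

  contains-flip : ∀ {L a b} → contains L a b ≡ true → contains L b a ≡ true
  contains-flip h = let (_ , e∈L , j) = contains-sound h in contains-complete e∈L (Joins-sym j)

  -- The clique through vx and xy and the one through vy and xy coincide only for triangular wings.
  wing-edge-cliques : ∀ {x y} → Wing x y → 1 + 𝟙 (not (triangular x y)) ≤ sum (λ L → 𝟙 (contains L x y))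
  wing-edge-cliques {x} {y} w
    with common-clique (adj-flip (v~x w)) (x~y w) (adj⇒≢ (v~y w))
       | common-clique (adj-flip (v~y w)) (adj-flip (x~y w)) (adj⇒≢ (v~x w))
  ... | L₁ , vx₁ , xy₁ | L₂ , vy₂ , yx₂ with triangular x y in t
  ... | true  = ≤-trans (≡true⇒1≤𝟙 xy₁) (term≤∑ (λ L → 𝟙 (contains L x y)) L₁)
  ... | false = 2≤∑ (λ L → 𝟙 (contains L x y)) L₁≢L₂ (≡true⇒1≤𝟙 xy₁) (≡true⇒1≤𝟙 (contains-flip yx₂))
    where
    L₁≢L₂ : L₁ ≢ L₂
    L₁≢L₂ refl = true≢false (trans (sym (triangular-complete (contains-flip vx₁ , contains-flip vy₂ , xy₁))) t)

  wings triangularWings splitWings : ℕ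
  wings           = sum λ x → sum λ y → 𝟙 (wing x y)
  triangularWings = sum λ x → sum λ y → 𝟙 (matched x y)
  splitWings      = sum λ x → sum λ y → 𝟙 (wing x y ∧ not (triangular x y))

  wings≡triangular+split : wings ≡ triangularWings + splitWings
  wings≡triangular+split =
    trans (sum-cong-≗ (λ x → trans (sum-cong-≗ (split x)) (∑-distrib-+ (λ y → 𝟙 (matched x y)) (λ y → 𝟙 (wing x y ∧ not (triangular x y))))))
          (∑-distrib-+ (λ x → sum (λ y → 𝟙 (matched x y))) (λ x → sum (λ y → 𝟙 (wing x y ∧ not (triangular x y)))))
    where
    split : ∀ x y → 𝟙 (wing x y) ≡ 𝟙 (matched x y) + 𝟙 (wing x y ∧ not (triangular x y))
    split x y with wing x y | triangular x y
    ... | true  | true  = refl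
    ... | true  | false = refl
    ... | false | _     = refl

  wings+splitWings≤∑wingEdgesIn : wings + splitWings ≤ sum wingEdgesIn
  wings+splitWings≤∑wingEdgesIn = begin
    wings + splitWings
      ≡⟨ sym (∑-distrib-+ (λ x → sum (λ y → 𝟙 (wing x y))) (λ x → sum (λ y → 𝟙 (wing x y ∧ not (triangular x y))))) ⟩
    sum (λ x → sum (λ y → 𝟙 (wing x y)) + sum (λ y → 𝟙 (wing x y ∧ not (triangular x y))))
      ≡⟨ sum-cong-≗ (λ x → sym (∑-distrib-+ (λ y → 𝟙 (wing x y)) (λ y → 𝟙 (wing x y ∧ not (triangular x y))))) ⟩
    sum (λ x → sum (λ y → 𝟙 (wing x y) + 𝟙 (wing x y ∧ not (triangular x y))))
      ≤⟨ ∑-mono-≤ (λ x → ∑-mono-≤ (λ y → pointwise x y)) ⟩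
    sum (λ x → sum (λ y → sum (λ L → 𝟙 (wing x y ∧ contains L x y))))
      ≡⟨ sum-cong-≗ (λ x → ∑-comm (λ y L → 𝟙 (wing x y ∧ contains L x y))) ⟩
    sum (λ x → sum (λ L → sum (λ y → 𝟙 (wing x y ∧ contains L x y))))
      ≡⟨ ∑-comm (λ x L → sum (λ y → 𝟙 (wing x y ∧ contains L x y))) ⟩
    sum wingEdgesIn ∎
    where
    open ≤-Reasoning
    pointwise : ∀ x y → 𝟙 (wing x y) + 𝟙 (wing x y ∧ not (triangular x y)) ≤ sum (λ L → 𝟙 (wing x y ∧ contains L x y))
    pointwise x y with wing x y in w
    ... | false = z≤n
    ... | true  = wing-edge-cliques (isWing⇒Wing w)

  ∑wingEdgesIn+∑wingFree≤N : sum wingEdgesIn + sum (𝟙 ∘ wingFree) ≤ N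
  ∑wingEdgesIn+∑wingFree≤N = begin
    sum wingEdgesIn + sum (𝟙 ∘ wingFree)       ≡⟨ sym (∑-distrib-+ wingEdgesIn (𝟙 ∘ wingFree)) ⟩
    sum (λ L → wingEdgesIn L + 𝟙 (wingFree L)) ≤⟨ ∑-mono-≤ (λ L → at-most-one (wingEdgesIn L) (wingEdgesIn≤1 L)) ⟩
    sum {N} (λ _ → 1)                          ≡⟨ trans (∑-const N 1) (*-identityʳ N) ⟩
    N                                          ∎
    where
    open ≤-Reasoning
    at-most-one : ∀ m → m ≤ 1 → m + 𝟙 (m ≡ᵇ 0) ≤ 1
    at-most-one zero          _ = ≤-refl
    at-most-one (suc zero)    _ = ≤-refl
    at-most-one (suc (suc _)) (s≤s ())

  some-wing : 1 ≤ wings → ∃ λ x → ∃ λ y → Wing x y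
  some-wing h with ∑-positive⇒∃ (λ x → sum (λ y → 𝟙 (wing x y))) h
  ... | x , hx with ∑-positive⇒∃ (λ y → 𝟙 (wing x y)) hx
  ... | y , hy = x , y , isWing⇒Wing (1≤𝟙⇒≡true hy)

  triangularWings+1≤∑wingFree : ∀ {x y} → Wing x y → triangularWings + 1 ≤ sum (𝟙 ∘ wingFree)
  triangularWings+1≤∑wingFree w = CompleteMinusMatchingBound.matchingSize+1≤usedBlocks (stalkPartition w)

  2*wings+1≤N : 1 ≤ wings → 2 * wings + 1 ≤ N
  2*wings+1≤N h = begin
    2 * wings + 1                                ≡⟨ cong (λ m → wings + m + 1) (trans (+-identityʳ wings) wings≡triangular+split) ⟩
    wings + (triangularWings + splitWings) + 1   ≡⟨ regroup wings triangularWings splitWings ⟩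
    (wings + splitWings) + (triangularWings + 1) ≤⟨ +-mono-≤ wings+splitWings≤∑wingEdgesIn
                                                             (triangularWings+1≤∑wingFree (proj₂ (proj₂ (some-wing h)))) ⟩
    sum wingEdgesIn + sum (𝟙 ∘ wingFree)         ≤⟨ ∑wingEdgesIn+∑wingFree≤N ⟩
    N                                            ∎
    where
    open ≤-Reasoning
    regroup : ∀ w a b → w + (a + b) + 1 ≡ (w + b) + (a + 1)
    regroup = solve-∀

  wingCount≡wings : wingCount G v ≡ wings
  wingCount≡wings = trans (sum-allFin n (λ x → List.sum (map (λ y → 𝟙 (wing x y)) (allFin n)))) (sum-cong-≗ (λ x → sum-allFin n (λ y → 𝟙 (wing x y))))

mainTheorem10 : (n : ℕ) (G : SimpleGraph n) → Connected G →
                (P : List (List (Edge G))) → EdgeCliquePartition G P →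
                (v : Fin n) (t : ℕ) → 1 ≤ t → wingCount G v ≡ t →
                2 * t + 1 ≤ length P
mainTheorem10 n G _ P ecp v t 1≤t refl =
  subst (λ w → 2 * w + 1 ≤ length P) (sym wingCount≡wings) (2*wings+1≤N (subst (1 ≤_) wingCount≡wings 1≤t))
  where open CliquesAtAStalk G P ecp v
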